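{- Let $G=(V_G,E_G)$ be a digraph such that there is a 2-partition $(V_1,V_2)$ of $V_G$ (into nonempty sets) with $\{(u,v)\mid u\in V_1, v\in V_2\}\subseteq E_G$. If $A'$ is a feasible solution for SSGW on $G$ such that $V_1\subseteq A'$, then $A'\cap V_2$ is a feasible solution for SSGW on the induced subdigraph $G[V_2]$.
   Context: Vertices carry positive integer sizes and there is a positive integer capacity $c$ (the same for all digraphs considered). A subset $A'$ of the vertex set of a digraph $D$ is a feasible solution for SSGW on $D$ if the sum of the sizes of vertices in $A'$ is at most $c$ and for every vertex $y$ of $D$, if $y$ has at least one predecessor in $D$ and all predecessors of $y$ in $D$ lie in $A'$, then $y\in A'$. -}

module Defs where

open import Data.Nat using (ℕ; zero; suc; _+_; _≤_)
open import Data.Fin using (Fin) renaming (zero to fz; suc to fs)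
open import Data.Fin.Subset using (Subset; _∈_; _∉_; _⊆_; ⊤; ⊥; _∩_; Nonempty)
open import Data.Vec using (Vec; lookup)
open import Data.Bool using (Bool; true; false; if_then_else_)
open import Data.Product using (Σ; ∃; _×_; _,_)
open import Relation.Binary.PropositionalEquality using (_≡_)

record Digraph (n : ℕ) : Set₁ where
  field
    Edge : Fin n → Fin n → Set

open Digraph public

Σᶠ : ∀ {n} → (Fin n → ℕ) → ℕ
Σᶠ {zero}  f = 0
Σᶠ {suc n} f = f fz + Σᶠ {n} (λ i → f (fs i))

size : ∀ {n} → (Fin n → ℕ) → Subset n → ℕ
size s A = Σᶠ (λ i → if lookup A i then s i else 0)

-- Feasible solution for SSGW on the induced subdigraph D[W]
-- (vertices W, edges of D with both ends in W), with sizes s and capacity c.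
-- A' must be a subset of the vertex set W.
FeasibleOn : ∀ {n} → Digraph n → (s : Fin n → ℕ) → (c : ℕ) →
             (W : Subset n) → (A' : Subset n) → Set
FeasibleOn {n} D s c W A' =
  A' ⊆ W ×
  size s A' ≤ c ×
  (∀ y → y ∈ W →
     (Σ (Fin n) λ x → x ∈ W × Edge D x y) →
     (∀ x → x ∈ W → Edge D x y → x ∈ A') →
     y ∈ A')

Feasible : ∀ {n} → Digraph n → (s : Fin n → ℕ) → (c : ℕ) → Subset n → Set
Feasible D s c A' = FeasibleOn D s c ⊤ A'

module Submission where

-- For A' ∩ V₂ on G[V₂] each part follows
-- from a general fact:
--   * the total size is monotone under inclusion, so shrinking a solution
--     keeps it within capacity;
--   * closure of A' on D transfers to closure of A' ∩ W on D[W] whenever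
--     every predecessor outside W of a vertex in W is already in A';
--   * if V₁ and V₂ cover the vertex set and V₁ ⊆ A', every vertex outside V₂
--     is in A', so the previous fact applies with W = V₂.

open import Defs
open import Data.Nat using (ℕ; _≤_; _>_; zero; suc; z≤n)
open import Data.Nat.Properties using (≤-refl; ≤-trans; +-mono-≤)
open import Data.Fin using (Fin) renaming (zero to fz; suc to fs)
open import Data.Fin.Subset using (Subset; _∈_; _∉_; _⊆_; _∩_; Nonempty; ⊤)
open import Data.Fin.Subset.Properties using (∈⊤; _∈?_; x∈p∩q⁺; x∈p∩q⁻; p∩q⊆p; p∩q⊆q)
open import Data.Vec using ([]; _∷_; here; there)
open import Data.Bool using (true; false; if_then_else_)
open import Data.Product using (Σ; _×_; _,_; proj₁)
open import Data.Sum using (_⊎_; inj₁; inj₂)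
open import Data.Empty using (⊥; ⊥-elim)
open import Relation.Nullary using (yes; no)

size-mono : ∀ {n} (s : Fin n → ℕ) (p q : Subset n) → p ⊆ q → size s p ≤ size s q
size-mono {zero}  s []      []      p⊆q = z≤n
size-mono {suc n} s (a ∷ p) (b ∷ q) p⊆q =
  +-mono-≤ (head-≤ a b p⊆q) (size-mono (λ i → s (fs i)) p q tail-⊆)
  where
  head-≤ : ∀ a b → (a ∷ p) ⊆ (b ∷ q) →
           (if a then s fz else 0) ≤ (if b then s fz else 0)
  head-≤ false b    _    = z≤n
  head-≤ true  true _    = ≤-refl
  head-≤ true  false a⊆b with a⊆b here
  ... | ()

  tail-⊆ : p ⊆ q
  tail-⊆ i∈p with p⊆q (there i∈p)
  ... | there i∈q = i∈q

ClosedOn : ∀ {n} → Digraph n → Subset n → Subset n → Set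
ClosedOn {n} D W A' =
  ∀ y → y ∈ W →
    (Σ (Fin n) λ x → x ∈ W × Edge D x y) →
    (∀ x → x ∈ W → Edge D x y → x ∈ A') →
    y ∈ A'

closed-restrict : ∀ {n} (D : Digraph n) (W A' : Subset n) →
  ClosedOn D ⊤ A' →
  (∀ x y → x ∉ W → y ∈ W → Edge D x y → x ∈ A') →
  ClosedOn D W (A' ∩ W)
closed-restrict D W A' closed outside-in y y∈W (x , x∈W , x→y) preds∈A'∩W =
  x∈p∩q⁺ (closed y ∈⊤ (x , ∈⊤ , x→y) preds∈A' , y∈W)
  where
  preds∈A' : ∀ z → z ∈ ⊤ → Edge D z y → z ∈ A'
  preds∈A' z _ z→y with z ∈? W
  ... | yes z∈W = proj₁ (x∈p∩q⁻ A' W (preds∈A'∩W z z∈W z→y))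
  ... | no  z∉W = outside-in z y z∉W y∈W z→y

outside-covered : ∀ {n} (V₁ V₂ A' : Subset n) →
  (∀ v → v ∈ V₁ ⊎ v ∈ V₂) → V₁ ⊆ A' → ∀ x → x ∉ V₂ → x ∈ A'
outside-covered V₁ V₂ A' cover V₁⊆A' x x∉V₂ with cover x
... | inj₁ x∈V₁ = V₁⊆A' x∈V₁
... | inj₂ x∈V₂ = ⊥-elim (x∉V₂ x∈V₂)

-- Lemma 9.
lemma9 : ∀ {n} (G : Digraph n) (s : Fin n → ℕ) (c : ℕ) →
         (∀ v → s v > 0) → c > 0 →
         (V₁ V₂ : Subset n) →
         Nonempty V₁ → Nonempty V₂ →
         (∀ v → (v ∈ V₁ ⊎ v ∈ V₂)) →
         (∀ v → v ∈ V₁ → v ∈ V₂ → ⊥) →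
         (∀ u v → u ∈ V₁ → v ∈ V₂ → Edge G u v) →
         (A' : Subset n) → Feasible G s c A' → V₁ ⊆ A' →
         FeasibleOn G s c V₂ (A' ∩ V₂)
lemma9 G s c _ _ V₁ V₂ _ _ cover _ _ A' (_ , within-c , closed) V₁⊆A' =
    p∩q⊆q A' V₂
  , ≤-trans (size-mono s (A' ∩ V₂) A' (p∩q⊆p A' V₂)) within-c
  , closed-restrict G V₂ A' closed
      (λ x _ x∉V₂ _ _ → outside-covered V₁ V₂ A' cover V₁⊆A' x x∉V₂)
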